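{- Let $\mathcal{A},\mathcal{B}$ be finite disjoint alphabets of modalities, $L_1$ a normal modal logic over $\mathcal{A}$ and $L_2$ a normal modal logic over $\mathcal{B}$. If $L_1$ and $L_2$ are locally tabular, then the logic $L_1\oplus^{\mathrm{lex}} L_2$ is locally tabular.
   Context: Given an $\mathcal{A}$-frame $I=(Y,(S_\Diamond)_{\Diamond\in\mathcal{A}})$ and a family of $\mathcal{B}$-frames $F_i=(X_i,(R_{i,\Diamond})_{\Diamond\in\mathcal{B}})$, $i\in Y$, the lexicographic sum is the $(\mathcal{A}\cup\mathcal{B})$-frame with domain $\bigcup_{i\in Y}\{i\}\times X_i$, where for $\Diamond\in\mathcal{A}$: $(i,a)S^\oplus_\Diamond(j,b)$ iff $iS_\Diamond j$; and for $\Diamond\in\mathcal{B}$: $(i,a)R_\Diamond(j,b)$ iff $i=j$ and $aR_{i,\Diamond}b$. $L_1\oplus^{\mathrm{lex}}L_2$ denotes the set of $(\mathcal{A}\cup\mathcal{B})$-formulas valid in all lexicographic sums over $\mathcal{A}$-frames validating $L_1$ of families of $\mathcal{B}$-frames validating $L_2$. A logic $L$ is locally tabular if for every $k<\omega$ there are only finitely many formulas in $p_0,\ldots,p_{k-1}$ pairwise non-equivalent modulo $L$. -}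

module Defs where

open import Level using (Level; _⊔_) renaming (suc to lsuc; zero to lzero)
open import Data.Nat using (ℕ; zero; suc; _<_)
open import Data.Fin using (Fin)
open import Data.Bool using (Bool; true; false; _∨_; not)
open import Data.Sum using (_⊎_; inj₁; inj₂)
open import Data.Product using (Σ; _×_; _,_)
open import Data.Empty using (⊥)
open import Relation.Binary.PropositionalEquality using (_≡_)
open import Relation.Nullary using (¬_)

infixr 5 _⇒_

data Fm (M : Set) : Set where
  var : ℕ → Fm M
  ⊥′  : Fm M
  _⇒_ : Fm M → Fm M → Fm M
  ◇   : M → Fm M → Fm M

module _ {M : Set} where

  ¬′ : Fm M → Fm M
  ¬′ φ = φ ⇒ ⊥′

  _∧′_ : Fm M → Fm M → Fm M
  φ ∧′ ψ = ¬′ (φ ⇒ ¬′ ψ)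

  _⇔_ : Fm M → Fm M → Fm M
  φ ⇔ ψ = (φ ⇒ ψ) ∧′ (ψ ⇒ φ)

  □ : M → Fm M → Fm M
  □ a φ = ¬′ (◇ a (¬′ φ))

  _[_] : Fm M → (ℕ → Fm M) → Fm M
  var p   [ σ ] = σ p
  ⊥′      [ σ ] = ⊥′
  (φ ⇒ ψ) [ σ ] = (φ [ σ ]) ⇒ (ψ [ σ ])
  ◇ a φ   [ σ ] = ◇ a (φ [ σ ])

  VarsBelow : ℕ → Fm M → Set
  VarsBelow k (var p) = p < k
  VarsBelow k ⊥′      = Data.Unit.⊤ where import Data.Unit
  VarsBelow k (φ ⇒ ψ) = VarsBelow k φ × VarsBelow k ψ
  VarsBelow k (◇ a φ) = VarsBelow k φ

  evalB : (Fm M → Bool) → Fm M → Bool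
  evalB v (var p) = v (var p)
  evalB v ⊥′      = false
  evalB v (φ ⇒ ψ) = not (evalB v φ) ∨ evalB v ψ
  evalB v (◇ a φ) = v (◇ a φ)

  -- φ is a (substitution instance of a) classical propositional tautology
  Taut : Fm M → Set
  Taut φ = ∀ (v : Fm M → Bool) → evalB v φ ≡ true

  record IsNormal {ℓ : Level} (L : Fm M → Set ℓ) : Set ℓ where
    field
      taut : ∀ φ → Taut φ → L φ
      axK  : ∀ a → L (□ a (var 0 ⇒ var 1) ⇒ (□ a (var 0) ⇒ □ a (var 1)))
      mp   : ∀ φ ψ → L (φ ⇒ ψ) → L φ → L ψ
      nec  : ∀ a φ → L φ → L (□ a φ)
      sub  : ∀ (σ : ℕ → Fm M) φ → L φ → L (φ [ σ ])

  -- Local tabularity: for each k, the formulas in p₀ … p_{k-1} fall into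
  -- finitely many classes modulo L (φ ~ ψ iff φ ⇔ ψ ∈ L).

  LocallyTabular : {ℓ : Level} → (Fm M → Set ℓ) → Set ℓ
  LocallyTabular L =
    ∀ (k : ℕ) → Σ ℕ λ N → Σ (Fin N → Fm M) λ f →
      ((i : Fin N) → VarsBelow k (f i)) ×
      (∀ φ → VarsBelow k φ → Σ (Fin N) λ i → L (φ ⇔ f i))

  -- Kripke frames and (classical) Kripke semantics.
  -- Truth values are ¬¬-stable so that the semantics is the classical one.

  record Frame : Set₁ where
    field
      W : Set
      R : M → W → W → Set

  open Frame public

  Sat : (F : Frame) → (ℕ → W F → Set) → W F → Fm M → Set
  Sat F V w (var p) = ¬ ¬ V p w
  Sat F V w ⊥′      = ⊥
  Sat F V w (φ ⇒ ψ) = Sat F V w φ → Sat F V w ψ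
  Sat F V w (◇ a φ) = ¬ ¬ (Σ (W F) λ u → R F a w u × Sat F V u φ)

  Valid : Frame → Fm M → Set₁
  Valid F φ = ∀ (V : ℕ → W F → Set) (w : W F) → Sat F V w φ

  Validates : {ℓ : Level} → Frame → (Fm M → Set ℓ) → Set (lsuc lzero ⊔ ℓ)
  Validates F L = ∀ φ → L φ → Valid F φ

-- Lexicographic sums.  Alphabets 𝒜 = Fin m, ℬ = Fin n; 𝒜 ∪ ℬ is the
-- disjoint union Fin m ⊎ Fin n.

module _ {A B : Set} where

  data LexR (I : Frame {A}) (F : W I → Frame {B}) :
         (A ⊎ B) → Σ (W I) (λ i → W (F i)) → Σ (W I) (λ i → W (F i)) → Set where
    outer : ∀ {a i j x y} → R I a i j → LexR I F (inj₁ a) (i , x) (j , y)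
    inner : ∀ {b i x y} → R (F i) b x y → LexR I F (inj₂ b) (i , x) (i , y)

  LexSum : (I : Frame {A}) → (W I → Frame {B}) → Frame {A ⊎ B}
  LexSum I F = record { W = Σ (W I) (λ i → W (F i)) ; R = LexR I F }

  LexLogic : {ℓ₁ ℓ₂ : Level} → (Fm A → Set ℓ₁) → (Fm B → Set ℓ₂) →
             Fm (A ⊎ B) → Set (lsuc lzero ⊔ ℓ₁ ⊔ ℓ₂)
  LexLogic L₁ L₂ φ =
    ∀ (I : Frame {A}) → Validates I L₁ →
    ∀ (F : W I → Frame {B}) → (∀ i → Validates (F i) L₂) →
    Valid (LexSum I F) φ

-- Fix k and let s range over the finitely many L₂-classes of ℬ-formulas in p₀ … p_{k-1}, with
-- representatives rep₂ s. Read the letter p_s as "the current cluster has a point satisfying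
-- rep₂ s"; then 𝒜-formulas in these letters have finitely many L₁-classes, so at an
-- outer point i only finitely many atoms ◇α (rep₁ c) matter, and their truth values form a
-- finite profile of i. By induction on φ, the truth of φ at (i, a) is the truth of rep₂ s at a
-- in the cluster of i, for an s determined by the profile of i alone: a finite code (a decision
-- tree from profiles to classes). Formulas with equal codes are equivalent in every
-- lexicographic sum, and closing p₀ … p_{k-1} under the connectives realises every code
-- after finitely many rounds.

module Submission where

open import Defs
open import Level using (Level; 0ℓ)
open import Data.Bool using (Bool; true; false; T)
open import Data.Empty using (⊥-elim)
open import Data.Fin using (Fin; toℕ; fromℕ<; combine; remQuot)
  renaming (zero to fzero; suc to fsuc)
open import Data.Fin.Properties using (toℕ<n; toℕ-fromℕ<; toℕ-injective; remQuot-combine)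
  renaming (_≟_ to _≟ᶠ_)
open import Data.List using (List; []; _∷_; _++_; map; length; lookup; filter; allFin;
  cartesianProductWith)
open import Data.List.Membership.Propositional using (_∈_; find; lose)
open import Data.List.Membership.Propositional.Properties
  using (∈-++⁺ˡ; ∈-++⁺ʳ; ∈-map⁺; ∈-allFin; ∈-filter⁺; ∈-cartesianProductWith⁺)
open import Data.List.Properties using (filter-notAll)
open import Data.List.Relation.Unary.All as All using (All; all?)
open import Data.List.Relation.Unary.All.Properties using (¬All⇒Any¬)
open import Data.List.Relation.Unary.Any as Any using (Any; here; there; any?)
open import Data.List.Relation.Unary.Any.Properties using (++⁺ˡ; lookup-index)
open import Data.Nat using (ℕ; zero; suc; _<_; _*_; _<?_)
open import Data.Nat.Induction using (<-wellFounded)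
open import Data.Product using (Σ; _×_; _,_; proj₁; proj₂; map₂)
open import Data.Product.Properties using (≡-dec)
open import Data.Sum using (_⊎_; inj₁; inj₂)
open import Data.Unit using (tt)
open import Data.Vec using (Vec; []; _∷_) renaming (lookup to lookupᵛ)
open import Effect.Monad using (RawMonad)
open import Function using (_∘_; const; id)
open import Function.Bundles using (mk⇔; module Equivalence) renaming (_⇔_ to _⟷_)
open import Function.Properties.Equivalence using (⇔-setoid)
  renaming (refl to ⟷-refl; trans to ⟷-trans)
open import Function.Related.TypeIsomorphisms using (→-cong-⇔; ¬-cong-⇔)
open import Induction.WellFounded using (Acc; acc)
open import Relation.Binary.Definitions using (DecidableEquality)
open import Relation.Binary.PropositionalEquality using (_≡_; refl; sym; cong; cong₂; subst)
open import Relation.Nullary using (¬_; Dec; yes; no; ¬?; ¬¬-excluded-middle)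
open import Relation.Nullary.Negation using (Stable; negated-stable; ¬¬-map; ¬¬-Monad)
open import Relation.Unary using (Decidable)
import Relation.Binary.Reasoning.Setoid as SetoidReasoning

open Equivalence using (to; from)
open RawMonad (¬¬-Monad {0ℓ}) using (_>>=_; pure)
module ⟷-Reasoning = SetoidReasoning (⇔-setoid 0ℓ)

¬¬-⟷ : {A B : Set} → Stable A → Stable B → ¬ ¬ (A ⟷ B) → A ⟷ B
¬¬-⟷ stableA stableB ¬¬e =
  mk⇔ (λ a → stableB (¬¬-map (λ e → to e a) ¬¬e)) (λ b → stableA (¬¬-map (λ e → from e b) ¬¬e))

IsProfile : ∀ {j} → (Fin j → Set) → Vec Bool j → Set
IsProfile Q P = ∀ x → Q x ⟷ T (lookupᵛ P x)

profile-exists : ∀ {j} (Q : Fin j → Set) → ¬ ¬ Σ (Vec Bool j) (IsProfile Q)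
profile-exists {zero} Q = pure ([] , λ ())
profile-exists {suc j} Q =
  profile-exists (Q ∘ fsuc) >>= λ profile → ¬¬-map (λ q? → extend q? profile) ¬¬-excluded-middle
  where
  extend : Dec (Q fzero) → Σ (Vec Bool j) (IsProfile (Q ∘ fsuc)) → Σ (Vec Bool (suc j)) (IsProfile Q)
  extend (yes q) (P , isP) = true ∷ P , λ { fzero → mk⇔ (const tt) (const q) ; (fsuc x) → isP x }
  extend (no ¬q) (P , isP) = false ∷ P , λ { fzero → mk⇔ ¬q λ () ; (fsuc x) → isP x }

Tree : ℕ → Set → Set
Tree zero    Λ = Λ
Tree (suc j) Λ = Tree j Λ × Tree j Λ

module _ {Λ : Set} where

  lookupTree : ∀ {j} → Tree j Λ → Vec Bool j → Λ
  lookupTree {zero}  t       []          = t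
  lookupTree {suc j} (l , r) (false ∷ P) = lookupTree l P
  lookupTree {suc j} (l , r) (true ∷ P)  = lookupTree r P

  tabulateTree : ∀ {j} → (Vec Bool j → Λ) → Tree j Λ
  tabulateTree {zero}  g = g []
  tabulateTree {suc j} g = tabulateTree (g ∘ (false ∷_)) , tabulateTree (g ∘ (true ∷_))

  lookupTree∘tabulateTree : ∀ {j} (g : Vec Bool j → Λ) P → lookupTree (tabulateTree g) P ≡ g P
  lookupTree∘tabulateTree {zero}  g []          = refl
  lookupTree∘tabulateTree {suc j} g (false ∷ P) = lookupTree∘tabulateTree (g ∘ (false ∷_)) P
  lookupTree∘tabulateTree {suc j} g (true ∷ P)  = lookupTree∘tabulateTree (g ∘ (true ∷_)) P

  Tree-≟ : ∀ {j} → DecidableEquality Λ → DecidableEquality (Tree j Λ)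
  Tree-≟ {zero}  _≟_ = _≟_
  Tree-≟ {suc j} _≟_ = ≡-dec (Tree-≟ _≟_) (Tree-≟ _≟_)

  allTrees : ∀ j → List Λ → List (Tree j Λ)
  allTrees zero    xs = xs
  allTrees (suc j) xs = cartesianProductWith _,_ (allTrees j xs) (allTrees j xs)

  ∈-allTrees : ∀ {j xs} → (∀ x → x ∈ xs) → (t : Tree j Λ) → t ∈ allTrees j xs
  ∈-allTrees {zero}  complete t       = complete t
  ∈-allTrees {suc j} complete (l , r) =
    ∈-cartesianProductWith⁺ _,_ (∈-allTrees complete l) (∈-allTrees complete r)

module _ {M : Set} where

  ite : Fm M → Fm M → Fm M → Fm M
  ite θ φ ψ = (θ ⇒ φ) ∧′ (¬′ θ ⇒ ψ)

  caseFm : ∀ {j} {Λ : Set} → (Fin j → Fm M) → (Λ → Fm M) → Tree j Λ → Fm M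
  caseFm {zero}  atom leaf t       = leaf t
  caseFm {suc j} atom leaf (l , r) =
    ite (atom fzero) (caseFm (atom ∘ fsuc) leaf r) (caseFm (atom ∘ fsuc) leaf l)

  caseFm-vars : ∀ {j N} {Λ : Set} {atom : Fin j → Fm M} {leaf : Λ → Fm M} →
    (∀ x → VarsBelow N (atom x)) → (∀ s → VarsBelow N (leaf s)) →
    ∀ t → VarsBelow N (caseFm atom leaf t)
  caseFm-vars {zero}  atom-vars leaf-vars t       = leaf-vars t
  caseFm-vars {suc j} atom-vars leaf-vars (l , r) =
    ((atom-vars fzero , caseFm-vars (atom-vars ∘ fsuc) leaf-vars r) ,
     ((atom-vars fzero , tt) , caseFm-vars (atom-vars ∘ fsuc) leaf-vars l) , tt) , tt

module _ {M : Set} (G : Frame {M}) (V : ℕ → W G → Set) where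

  Sat-stable : ∀ w φ → Stable (Sat G V w φ)
  Sat-stable w (var p)   = negated-stable
  Sat-stable w ⊥′      h = h id
  Sat-stable w (φ ⇒ ψ) h = λ x → Sat-stable w ψ (¬¬-map (λ f → f x) h)
  Sat-stable w (◇ a φ)   = negated-stable

  Sat-∧ : ∀ {w} φ ψ → Sat G V w (φ ∧′ ψ) ⟷ (Sat G V w φ × Sat G V w ψ)
  Sat-∧ {w} φ ψ = mk⇔
    (λ h → Sat-stable w φ (λ ¬φ → h (λ x _ → ¬φ x)) , Sat-stable w ψ (λ ¬ψ → h (λ _ y → ¬ψ y)))
    (λ { (x , y) h → h x y })

  Sat-⇔ : ∀ {w} φ ψ → Sat G V w (φ ⇔ ψ) ⟷ (Sat G V w φ ⟷ Sat G V w ψ)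
  Sat-⇔ φ ψ = mk⇔
    (λ h → let f , g = to (Sat-∧ (φ ⇒ ψ) (ψ ⇒ φ)) h in mk⇔ f g)
    (λ e → from (Sat-∧ (φ ⇒ ψ) (ψ ⇒ φ)) (to e , from e))

  Validates⇒Sat-⟷ : ∀ {ℓ} {L : Fm M → Set ℓ} {φ ψ} →
    Validates G L → L (φ ⇔ ψ) → ∀ w → Sat G V w φ ⟷ Sat G V w ψ
  Validates⇒Sat-⟷ {φ = φ} {ψ} valid φ⇔ψ w = to (Sat-⇔ φ ψ) (valid _ φ⇔ψ V w)

  Sat-◇-cong : ∀ {a φ ψ} → (∀ u → Sat G V u φ ⟷ Sat G V u ψ) →
    ∀ w → Sat G V w (◇ a φ) ⟷ Sat G V w (◇ a ψ)
  Sat-◇-cong e w = mk⇔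
    (¬¬-map λ { (u , r , s) → u , r , to (e u) s })
    (¬¬-map λ { (u , r , s) → u , r , from (e u) s })

  Sat-ite-true : ∀ {w θ} φ ψ → Sat G V w θ → Sat G V w (ite θ φ ψ) ⟷ Sat G V w φ
  Sat-ite-true {θ = θ} φ ψ sθ = ⟷-trans (Sat-∧ (θ ⇒ φ) (¬′ θ ⇒ ψ))
    (mk⇔ (λ (f , _) → f sθ) (λ x → const x , λ ¬θ → ⊥-elim (¬θ sθ)))

  Sat-ite-false : ∀ {w θ} φ ψ → ¬ Sat G V w θ → Sat G V w (ite θ φ ψ) ⟷ Sat G V w ψ
  Sat-ite-false {θ = θ} φ ψ ¬θ = ⟷-trans (Sat-∧ (θ ⇒ φ) (¬′ θ ⇒ ψ))
    (mk⇔ (λ (_ , g) → g ¬θ) (λ y → (λ sθ → ⊥-elim (¬θ sθ)) , const y))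

  Sat-caseFm : ∀ {j} {Λ : Set} {atom : Fin j → Fm M} {leaf : Λ → Fm M} {w P} →
    IsProfile (λ x → Sat G V w (atom x)) P →
    ∀ t → Sat G V w (caseFm atom leaf t) ⟷ Sat G V w (leaf (lookupTree t P))
  Sat-caseFm {zero} {P = []} _ t = ⟷-refl
  Sat-caseFm {suc j} {atom = atom} {leaf} {P = true ∷ P} isP (l , r) =
    ⟷-trans (Sat-ite-true (caseFm (atom ∘ fsuc) leaf r) (caseFm (atom ∘ fsuc) leaf l)
               (from (isP fzero) tt))
            (Sat-caseFm (isP ∘ fsuc) r)
  Sat-caseFm {suc j} {atom = atom} {leaf} {P = false ∷ P} isP (l , r) =
    ⟷-trans (Sat-ite-false (caseFm (atom ∘ fsuc) leaf r) (caseFm (atom ∘ fsuc) leaf l)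
               (to (isP fzero)))
            (Sat-caseFm (isP ∘ fsuc) l)

record FmAlgebra (M C : Set) : Set where
  field
    varᶜ  : ℕ → C
    ⊥ᶜ    : C
    _⇒ᶜ_  : C → C → C
    ◇ᶜ    : M → C → C

  ⟦_⟧ : Fm M → C
  ⟦ var p ⟧   = varᶜ p
  ⟦ ⊥′ ⟧      = ⊥ᶜ
  ⟦ φ ⇒ ψ ⟧   = ⟦ φ ⟧ ⇒ᶜ ⟦ ψ ⟧
  ⟦ ◇ a φ ⟧   = ◇ᶜ a ⟦ φ ⟧

TabularAt : ∀ {ℓ} {M : Set} → (Fm M → Set ℓ) → ℕ → Set ℓ
TabularAt {M = M} L k =
  Σ ℕ λ N → Σ (Fin N → Fm M) λ f →
    ((i : Fin N) → VarsBelow k (f i)) ×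
    (∀ φ → VarsBelow k φ → Σ (Fin N) λ i → L (φ ⇔ f i))

module Saturation {M C : Set} (ms : List M) (∈-ms : ∀ a → a ∈ ms)
  (𝒞 : FmAlgebra M C) (_≟_ : DecidableEquality C) (cs : List C) (∈-cs : ∀ c → c ∈ cs)
  (k : ℕ) where

  open FmAlgebra 𝒞

  Fm≤ : Set
  Fm≤ = Σ (Fm M) (VarsBelow k)

  code : Fm≤ → C
  code = ⟦_⟧ ∘ proj₁

  _⇒≤_ : Fm≤ → Fm≤ → Fm≤
  (φ , vφ) ⇒≤ (ψ , vψ) = φ ⇒ ψ , vφ , vψ

  ◇≤ : M → Fm≤ → Fm≤
  ◇≤ a (φ , vφ) = ◇ a φ , vφ

  generators : List Fm≤
  generators = (⊥′ , tt) ∷ map (λ i → var (toℕ i) , toℕ<n i) (allFin k)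

  expand : List Fm≤ → List Fm≤
  expand xs = xs ++ (cartesianProductWith _⇒≤_ xs xs ++ cartesianProductWith ◇≤ ms xs)

  stage : ℕ → List Fm≤
  stage zero    = generators
  stage (suc d) = expand (stage d)

  generators⊆stage : ∀ d {g} → g ∈ generators → g ∈ stage d
  generators⊆stage zero    g∈ = g∈
  generators⊆stage (suc d) g∈ = ∈-++⁺ˡ (generators⊆stage d g∈)

  Realises : List Fm≤ → C → Set
  Realises xs c = Any (λ w → code w ≡ c) xs

  realises? : ∀ xs → Decidable (Realises xs)
  realises? xs c = any? (λ w → code w ≟ c) xs

  Saturated : List Fm≤ → Set
  Saturated xs = All (Realises xs ∘ code) (expand xs)

  saturated-realises : ∀ {xs} → Saturated xs → (∀ {g} → g ∈ generators → g ∈ xs) →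
    ∀ φ → VarsBelow k φ → Realises xs ⟦ φ ⟧
  saturated-realises sat gen⊆ (var p) p<k =
    lose (gen⊆ (there (∈-map⁺ _ (∈-allFin (fromℕ< p<k))))) (cong varᶜ (toℕ-fromℕ< p<k))
  saturated-realises sat gen⊆ ⊥′ _ = lose (gen⊆ (here refl)) refl
  saturated-realises {xs} sat gen⊆ (φ ⇒ ψ) (vφ , vψ) =
    let w₁ , w₁∈ , e₁ = find (saturated-realises sat gen⊆ φ vφ)
        w₂ , w₂∈ , e₂ = find (saturated-realises sat gen⊆ ψ vψ)
        w∈ = ∈-++⁺ʳ xs (∈-++⁺ˡ (∈-cartesianProductWith⁺ _⇒≤_ w₁∈ w₂∈))
    in subst (Realises xs) (cong₂ _⇒ᶜ_ e₁ e₂) (All.lookup sat w∈)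
  saturated-realises {xs} sat gen⊆ (◇ a φ) vφ =
    let w , w∈ , e = find (saturated-realises sat gen⊆ φ vφ)
        ◇w∈ = ∈-++⁺ʳ xs (∈-++⁺ʳ (cartesianProductWith _⇒≤_ xs xs)
                (∈-cartesianProductWith⁺ ◇≤ (∈-ms a) w∈))
    in subst (Realises xs) (cong (◇ᶜ a) e) (All.lookup sat ◇w∈)

  unrealised : ℕ → List C
  unrealised zero    = cs
  unrealised (suc d) = filter (¬? ∘ realises? (stage (suc d))) (unrealised d)

  ∈-unrealised : ∀ d {c} → ¬ Realises (stage d) c → c ∈ unrealised d
  ∈-unrealised zero    _  = ∈-cs _
  ∈-unrealised (suc d) ¬r =
    ∈-filter⁺ (¬? ∘ realises? (stage (suc d))) (∈-unrealised d (¬r ∘ ++⁺ˡ)) ¬r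

  unrealised-shrinks : ∀ d → ¬ Saturated (stage d) →
    length (unrealised (suc d)) < length (unrealised d)
  unrealised-shrinks d ¬sat =
    let w , w∈ , ¬r = find (¬All⇒Any¬ (realises? (stage d) ∘ code) _ ¬sat)
    in filter-notAll (¬? ∘ realises? (stage (suc d))) _
         (lose (∈-unrealised d ¬r) (λ ¬r′ → ¬r′ (lose w∈ refl)))

  saturate : ∀ d → Acc _<_ (length (unrealised d)) → Σ ℕ (Saturated ∘ stage)
  saturate d (acc rec) with all? (realises? (stage d) ∘ code) (expand (stage d))
  ... | yes sat  = d , sat
  ... | no  ¬sat = saturate (suc d) (rec (unrealised-shrinks d ¬sat))

  tabularAt : ∀ {ℓ} (L : Fm M → Set ℓ) →
    (∀ φ ψ → VarsBelow k φ → VarsBelow k ψ → ⟦ φ ⟧ ≡ ⟦ ψ ⟧ → L (φ ⇔ ψ)) → TabularAt L k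
  tabularAt L sound =
    let d , sat = saturate 0 (<-wellFounded _)
        reps    = stage d
    in length reps , proj₁ ∘ lookup reps , proj₂ ∘ lookup reps ,
       λ φ vφ → let r = saturated-realises sat (generators⊆stage d) φ vφ
                    i = Any.index r
                in i , sound φ _ vφ (proj₂ (lookup reps i)) (sym (lookup-index r))

module _ {A B : Set} (I : Frame {A}) (F : W I → Frame {B}) (V : ℕ → W (LexSum I F) → Set) where

  fibre : (i : W I) → ℕ → W (F i) → Set
  fibre i p b = V p (i , b)

  Sat-lex-◇inner : ∀ {i a β φ ψ} →
    (∀ b → Sat (LexSum I F) V (i , b) φ ⟷ Sat (F i) (fibre i) b ψ) →
    Sat (LexSum I F) V (i , a) (◇ (inj₂ β) φ) ⟷ Sat (F i) (fibre i) a (◇ β ψ)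
  Sat-lex-◇inner {i} e = mk⇔
    (¬¬-map λ { ((_ , b) , inner r , s) → b , r , to (e b) s })
    (¬¬-map λ { (b , r , s) → (i , b) , inner r , from (e b) s })

  Sat-lex-◇outer : (U : ℕ → W I → Set) → ∀ {i a α φ χ} →
    (∀ j → Sat I U j χ ⟷ (¬ ¬ Σ (W (F j)) λ b → Sat (LexSum I F) V (j , b) φ)) →
    Sat (LexSum I F) V (i , a) (◇ (inj₁ α) φ) ⟷ Sat I U i (◇ α χ)
  Sat-lex-◇outer U e = mk⇔
    (¬¬-map λ { ((j , b) , outer r , s) → j , r , from (e j) (λ ¬s → ¬s (b , s)) })
    (λ h → h >>= λ (j , r , sχ) → ¬¬-map (λ (b , s) → (j , b) , outer r , s) (to (e j) sχ))

module LexCode {ℓ₁ ℓ₂} {m n : ℕ} (L₁ : Fm (Fin m) → Set ℓ₁) (L₂ : Fm (Fin n) → Set ℓ₂)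
  (k : ℕ)
  {N₂ : ℕ} (rep₂ : Fin N₂ → Fm (Fin n)) (rep₂-vars : ∀ s → VarsBelow k (rep₂ s))
  (class₂ : ∀ ψ → VarsBelow k ψ → Σ (Fin N₂) λ s → L₂ (ψ ⇔ rep₂ s))
  {N₁ : ℕ} (rep₁ : Fin N₁ → Fm (Fin m)) (rep₁-vars : ∀ c → VarsBelow N₂ (rep₁ c))
  (class₁ : ∀ θ → VarsBelow N₂ θ → Σ (Fin N₁) λ c → L₁ (θ ⇔ rep₁ c)) where

  modalities : List (Fin m ⊎ Fin n)
  modalities = map inj₁ (allFin m) ++ map inj₂ (allFin n)

  ∈-modalities : ∀ a → a ∈ modalities
  ∈-modalities (inj₁ α) = ∈-++⁺ˡ (∈-map⁺ inj₁ (∈-allFin α))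
  ∈-modalities (inj₂ β) = ∈-++⁺ʳ (map inj₁ (allFin m)) (∈-map⁺ inj₂ (∈-allFin β))

  atom : Fin (m * N₁) → Fm (Fin m)
  atom x = ◇ (proj₁ (remQuot {m} N₁ x)) (rep₁ (proj₂ (remQuot {m} N₁ x)))

  atom-combine : ∀ α c → atom (combine α c) ≡ ◇ α (rep₁ c)
  atom-combine α c = cong (λ (α , c) → ◇ α (rep₁ c)) (remQuot-combine α c)

  Code : Set
  Code = Tree (m * N₁) (Fin N₂)

  outerFm : Code → Fm (Fin m)
  outerFm = caseFm atom (var ∘ toℕ)

  outerFm-vars : ∀ t → VarsBelow N₂ (outerFm t)
  outerFm-vars = caseFm-vars (rep₁-vars ∘ proj₂ ∘ remQuot {m} N₁) toℕ<n

  outerClass : Code → Fin N₁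
  outerClass t = proj₁ (class₁ (outerFm t) (outerFm-vars t))

  outerFm⇔outerClass : ∀ t → L₁ (outerFm t ⇔ rep₁ (outerClass t))
  outerFm⇔outerClass t = proj₂ (class₁ (outerFm t) (outerFm-vars t))

  classOf : ∀ ψ → VarsBelow k ψ → Fin N₂
  classOf ψ vψ = proj₁ (class₂ ψ vψ)

  truthClass : Bool → Fin N₂
  truthClass true  = classOf (¬′ ⊥′) (tt , tt)
  truthClass false = classOf ⊥′ tt

  pointwise : ∀ {ψ : Vec Bool (m * N₁) → Fm (Fin n)} → (∀ P → VarsBelow k (ψ P)) → Code
  pointwise {ψ} vψ = tabulateTree λ P → classOf (ψ P) (vψ P)

  -- Letters outside p₀ … p_{k-1} never occur in the formulas being classified, so their
  -- code is arbitrary.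
  varCode : ℕ → Code
  varCode p with p <? k
  ... | yes p<k = pointwise {const (var p)} (const p<k)
  ... | no  _   = pointwise {const ⊥′} (const tt)

  ◇Code : Fin m ⊎ Fin n → Code → Code
  ◇Code (inj₁ α) t = tabulateTree λ P → truthClass (lookupᵛ P (combine α (outerClass t)))
  ◇Code (inj₂ β) t = pointwise {λ P → ◇ β (rep₂ (lookupTree t P))} (rep₂-vars ∘ lookupTree t)

  lexAlgebra : FmAlgebra (Fin m ⊎ Fin n) Code
  lexAlgebra = record
    { varᶜ = varCode
    ; ⊥ᶜ   = pointwise {const ⊥′} (const tt)
    ; _⇒ᶜ_ = λ t u → pointwise {λ P → rep₂ (lookupTree t P) ⇒ rep₂ (lookupTree u P)}
                       (λ P → rep₂-vars _ , rep₂-vars _)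
    ; ◇ᶜ   = ◇Code
    }

  open FmAlgebra lexAlgebra using (⟦_⟧)

  module Semantics (I : Frame {Fin m}) (I⊨L₁ : Validates I L₁)
    (F : W I → Frame {Fin n}) (F⊨L₂ : ∀ i → Validates (F i) L₂)
    (V : ℕ → W (LexSum I F) → Set) where

    open ⟷-Reasoning

    Satˡ : W (LexSum I F) → Fm (Fin m ⊎ Fin n) → Set
    Satˡ = Sat (LexSum I F) V

    Satᶠ : (i : W I) → W (F i) → Fm (Fin n) → Set
    Satᶠ i = Sat (F i) (fibre I F V i)

    U : ℕ → W I → Set
    U p j = Σ (Fin N₂) λ s → toℕ s ≡ p × Σ (W (F j)) λ b → Satᶠ j b (rep₂ s)

    Satᴵ : W I → Fm (Fin m) → Set
    Satᴵ = Sat I U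

    Satᴵ-var : ∀ j s → Satᴵ j (var (toℕ s)) ⟷ (¬ ¬ Σ (W (F j)) λ b → Satᶠ j b (rep₂ s))
    Satᴵ-var j s = mk⇔
      (¬¬-map λ (_ , e , b , sat) → b , subst (Satᶠ j b ∘ rep₂) (toℕ-injective e) sat)
      (¬¬-map λ (b , sat) → s , refl , b , sat)

    Satᶠ-classOf : ∀ i a ψ vψ → Satᶠ i a ψ ⟷ Satᶠ i a (rep₂ (classOf ψ vψ))
    Satᶠ-classOf i a ψ vψ =
      Validates⇒Sat-⟷ (F i) (fibre I F V i) (F⊨L₂ i) (proj₂ (class₂ ψ vψ)) a

    Satᶠ-truthClass : ∀ i a b → Satᶠ i a (rep₂ (truthClass b)) ⟷ T b
    Satᶠ-truthClass i a true  = mk⇔ (const tt) (λ _ → to (Satᶠ-classOf i a (¬′ ⊥′) (tt , tt)) id)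
    Satᶠ-truthClass i a false = mk⇔ (from (Satᶠ-classOf i a ⊥′ tt)) λ ()

    Satᶠ-lookupTree-tabulate : ∀ {i a} (g : Vec Bool (m * N₁) → Fin N₂) P →
      Satᶠ i a (rep₂ (lookupTree (tabulateTree g) P)) ≡ Satᶠ i a (rep₂ (g P))
    Satᶠ-lookupTree-tabulate {i} {a} g P = cong (Satᶠ i a ∘ rep₂) (lookupTree∘tabulateTree g P)

    Satᶠ-pointwise : ∀ {i a} {ψ : Vec Bool (m * N₁) → Fm (Fin n)} vψ P →
      Satᶠ i a (ψ P) ⟷ Satᶠ i a (rep₂ (lookupTree (pointwise {ψ} vψ) P))
    Satᶠ-pointwise {i} {a} {ψ} vψ P = begin
      Satᶠ i a (ψ P)                                     ≈⟨ Satᶠ-classOf i a (ψ P) (vψ P) ⟩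
      Satᶠ i a (rep₂ (classOf (ψ P) (vψ P)))             ≡⟨ Satᶠ-lookupTree-tabulate _ P ⟨
      Satᶠ i a (rep₂ (lookupTree (pointwise {ψ} vψ) P))  ∎

    AtomProfile : W I → Vec Bool (m * N₁) → Set
    AtomProfile i = IsProfile (λ x → Satᴵ i (atom x))

    CodeCorrect : Fm (Fin m ⊎ Fin n) → Code → Set
    CodeCorrect φ t =
      ∀ {i P} → AtomProfile i P → ∀ a → Satˡ (i , a) φ ⟷ Satᶠ i a (rep₂ (lookupTree t P))

    Satᴵ-outerFm : ∀ φ t → CodeCorrect φ t →
      ∀ j → Satᴵ j (outerFm t) ⟷ (¬ ¬ Σ (W (F j)) λ b → Satˡ (j , b) φ)
    Satᴵ-outerFm φ t correct j =
      ¬¬-⟷ (Sat-stable I U j (outerFm t)) negated-stable (¬¬-map atProfile (profile-exists _))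
      where
      atProfile : Σ (Vec Bool (m * N₁)) (AtomProfile j) →
        Satᴵ j (outerFm t) ⟷ (¬ ¬ Σ (W (F j)) λ b → Satˡ (j , b) φ)
      atProfile (Q , isQ) = begin
        Satᴵ j (outerFm t)                                        ≈⟨ Sat-caseFm I U isQ t ⟩
        Satᴵ j (var (toℕ (lookupTree t Q)))                       ≈⟨ Satᴵ-var j _ ⟩
        (¬ ¬ Σ (W (F j)) λ b → Satᶠ j b (rep₂ (lookupTree t Q)))  ≈⟨ ¬-cong-⇔ (¬-cong-⇔ fibrewise) ⟩
        (¬ ¬ Σ (W (F j)) λ b → Satˡ (j , b) φ)                    ∎
        where
        fibrewise : (Σ (W (F j)) λ b → Satᶠ j b (rep₂ (lookupTree t Q))) ⟷
                    (Σ (W (F j)) λ b → Satˡ (j , b) φ)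
        fibrewise = mk⇔ (map₂ (from (correct isQ _))) (map₂ (to (correct isQ _)))

    code-correct : ∀ φ → VarsBelow k φ → CodeCorrect φ ⟦ φ ⟧
    code-correct (var p) p<k {P = P} _ a with p <? k
    ... | yes p<k′ = Satᶠ-pointwise (const p<k′) P
    ... | no  p≮k  = ⊥-elim (p≮k p<k)
    code-correct ⊥′ _ {P = P} _ a = Satᶠ-pointwise (const tt) P
    code-correct (φ ⇒ ψ) (vφ , vψ) {P = P} isP a =
      ⟷-trans (→-cong-⇔ (code-correct φ vφ isP a) (code-correct ψ vψ isP a))
              (Satᶠ-pointwise (λ _ → rep₂-vars _ , rep₂-vars _) P)
    code-correct (◇ (inj₂ β) φ) vφ {P = P} isP a =
      ⟷-trans (Sat-lex-◇inner I F V (code-correct φ vφ isP)) (Satᶠ-pointwise (rep₂-vars ∘ _) P)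
    code-correct (◇ (inj₁ α) φ) vφ {i} {P} isP a = begin
      Satˡ (i , a) (◇ (inj₁ α) φ)   ≈⟨ Sat-lex-◇outer I F V U (Satᴵ-outerFm φ t (code-correct φ vφ)) ⟩
      Satᴵ i (◇ α (outerFm t))      ≈⟨ Sat-◇-cong I U
                                        (Validates⇒Sat-⟷ I U I⊨L₁ (outerFm⇔outerClass t)) i ⟩
      Satᴵ i (◇ α (rep₁ c))         ≡⟨ cong (Satᴵ i) (atom-combine α c) ⟨
      Satᴵ i (atom (combine α c))   ≈⟨ isP (combine α c) ⟩
      T (lookupᵛ P (combine α c))   ≈⟨ Satᶠ-truthClass i a _ ⟨
      Satᶠ i a (rep₂ (truthClass (lookupᵛ P (combine α c))))
                                    ≡⟨ Satᶠ-lookupTree-tabulate _ P ⟨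
      Satᶠ i a (rep₂ (lookupTree ⟦ ◇ (inj₁ α) φ ⟧ P)) ∎
      where
      t = ⟦ φ ⟧
      c = outerClass t

  codes-classify : ∀ φ ψ → VarsBelow k φ → VarsBelow k ψ → ⟦ φ ⟧ ≡ ⟦ ψ ⟧ →
    LexLogic L₁ L₂ (φ ⇔ ψ)
  codes-classify φ ψ vφ vψ φ≡ψ I I⊨L₁ F F⊨L₂ V (i , a) =
    from (Sat-⇔ (LexSum I F) V φ ψ)
      (¬¬-⟷ (Sat-stable _ V _ φ) (Sat-stable _ V _ ψ) (¬¬-map atProfile (profile-exists _)))
    where
    open Semantics I I⊨L₁ F F⊨L₂ V
    open ⟷-Reasoning
    atProfile : Σ (Vec Bool (m * N₁)) (AtomProfile i) → Satˡ (i , a) φ ⟷ Satˡ (i , a) ψ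
    atProfile (P , isP) = begin
      Satˡ (i , a) φ                        ≈⟨ code-correct φ vφ isP a ⟩
      Satᶠ i a (rep₂ (lookupTree ⟦ φ ⟧ P))  ≡⟨ cong (λ t → Satᶠ i a (rep₂ (lookupTree t P))) φ≡ψ ⟩
      Satᶠ i a (rep₂ (lookupTree ⟦ ψ ⟧ P))  ≈⟨ code-correct ψ vψ isP a ⟨
      Satˡ (i , a) ψ                        ∎

theorem5p7 : {ℓ₁ ℓ₂ : Level} (m n : ℕ)
    (L₁ : Fm (Fin m) → Set ℓ₁) (L₂ : Fm (Fin n) → Set ℓ₂) →
    IsNormal L₁ → IsNormal L₂ →
    LocallyTabular L₁ → LocallyTabular L₂ →
    LocallyTabular (LexLogic L₁ L₂)
theorem5p7 m n L₁ L₂ _ _ tabular₁ tabular₂ k =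
  let N₂ , rep₂ , rep₂-vars , class₂ = tabular₂ k
      N₁ , rep₁ , rep₁-vars , class₁ = tabular₁ N₂
      open LexCode L₁ L₂ k rep₂ rep₂-vars class₂ rep₁ rep₁-vars class₁
  in Saturation.tabularAt modalities ∈-modalities lexAlgebra (Tree-≟ _≟ᶠ_)
       (allTrees (m * N₁) (allFin N₂)) (∈-allTrees ∈-allFin) k (LexLogic L₁ L₂) codes-classify
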